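{- Let $k\ge0$ and let $w$ be a word of the form $a_{k-1}\dotsb a_1a_0$ or $1a_{k-1}\dotsb a_1a_0$, where each $a_i$ is either the word $11$ or the word $2$. Then $$f_w=(2k_1+1)(2k_2+1)\dotsb(2k_r+1),$$ where $\{k_1,\dotsc,k_r\}$ is the set of indices $i\in\{0,\dots,k-1\}$ for which $a_i=2$ (the empty product being $1$).
   Context: For $n\ge 0$, let $F(n)$ be the set of all words $w=x_1\dotsb x_l$ with each $x_i\in\{1,2\}$ and $\sum_i x_i=n$; the rank of such $w$ is $r(w)=n$, and $F=\coprod_{n\ge0}F(n)$ ($F(0)$ contains only the empty word $\emptyset$). The Young–Fibonacci graph has vertex set $F$, with an edge between $v\in F(n)$ and $w\in F(n+1)$ (written $v\in w^-$) iff either (1) $v$ is obtained from $w$ by changing into a $1$ some $2$ of $w$ that has no $1$ to its left, or (2) $v$ is obtained from $w$ by removing its leftmost $1$. The $f$-statistic is defined recursively by $f_\emptyset=1$ and $f_w=\sum_{v\in w^- }f_v$. -}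

module Defs where

open import Data.Nat using (ℕ; zero; suc; _+_; _*_)
open import Data.List using (List; []; _∷_; _++_; map; reverse; concatMap)
open import Data.Nat.ListAction using (sum; product)
open import Data.Maybe using (Maybe; just; nothing)
open import Data.Fin using (Fin; toℕ)
open import Data.List using (allFin)

data Letter : Set where
  one two : Letter

Word : Set
Word = List Letter

rank : Word → ℕ
rank [] = 0
rank (one ∷ w) = 1 + rank w
rank (two ∷ w) = 2 + rank w

-- rule (1): change into 1 some 2 having no 1 to its left
-- (i.e. one of the 2s in the leading block of 2s)
rule1 : Word → List Word
rule1 [] = []
rule1 (one ∷ w) = []
rule1 (two ∷ w) = (one ∷ w) ∷ map (two ∷_) (rule1 w)

rule2 : Word → Maybe Word
rule2 [] = nothing
rule2 (one ∷ w) = just w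
rule2 (two ∷ w) = Data.Maybe.map (two ∷_) (rule2 w)

maybeToList : {A : Set} → Maybe A → List A
maybeToList nothing = []
maybeToList (just x) = x ∷ []

-- w⁻ : the words of rank r(w) - 1 adjacent to w (all distinct)
down : Word → List Word
down w = rule1 w ++ maybeToList (rule2 w)

fAux : ℕ → Word → ℕ
fAux zero    w = 1
fAux (suc n) w = sum (map (fAux n) (down w))

f : Word → ℕ
f w = fAux (rank w) w

data Block : Set where
  b11 b2 : Block

blockWord : Block → Word
blockWord b11 = one ∷ one ∷ []
blockWord b2  = two ∷ []

-- the word a_{k-1} ⋯ a_1 a_0
blocksWord : (k : ℕ) → (Fin k → Block) → Word
blocksWord k a = concatMap blockWord (reverse (map a (allFin k)))

factor : ℕ → Block → ℕ
factor i b11 = 1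
factor i b2  = 2 * i + 1

blockProduct : (k : ℕ) → (Fin k → Block) → ℕ
blockProduct k a = product (map (λ i → factor (toℕ i) (a i)) (allFin k))

-- The down-set of 2w is {1w} ∪ {2v : v ∈ w⁻}, with every v of rank r(w) − 1, so by induction on
-- the rank f(2w) = f(w) + r(w) f(w) = (r(w) + 1) f(w); also f(1w) = f(w), since (1w)⁻ = {w}.
-- Hence f(w) is the product, over the letters 2 of w, of one plus the rank of the suffix after
-- that letter.  In a_{k-1} ⋯ a_0 the suffix after a_i has rank 2i, giving the factor 2i + 1.
module Submission where

open import Defs
open import Data.Nat using (ℕ; zero; suc; _+_; _*_)
open import Data.Nat.Properties using (+-identityʳ; +-assoc; +-comm; +-suc; *-suc; *-comm; *-identityʳ; *-assoc; *-distribˡ-+; *-zeroʳ; suc-injective)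
open import Data.Nat.ListAction using (sum; product)
open import Data.Fin using (Fin; toℕ)
import Data.Fin as Fin
open import Data.List using (List; []; _∷_; _++_; map; reverse; concatMap; tabulate; allFin)
open import Data.List.Properties using (map-++; map-∘; map-tabulate; tabulate-cong; unfold-reverse; concatMap-++; ++-identityʳ)
open import Data.List.Relation.Unary.All using (All; []; _∷_)
import Data.List.Relation.Unary.All as All
open import Data.List.Relation.Unary.All.Properties using (map⁺)
open import Data.Maybe using (Maybe; just; nothing)
import Data.Maybe as Maybe
open import Data.Product using (_×_; _,_)
open import Function using (_∘_; id)
open import Relation.Binary.PropositionalEquality using (_≡_; refl; sym; trans; cong; cong₂; module ≡-Reasoning)
open ≡-Reasoning

sum-map-scale : ∀ {A : Set} {P : A → Set} (c : ℕ) {g h : A → ℕ} →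
  (∀ {x} → P x → g x ≡ c * h x) → ∀ {xs} → All P xs → sum (map g xs) ≡ c * sum (map h xs)
sum-map-scale c _ []     = sym (*-zeroʳ c)
sum-map-scale c {g} {h} g≡c*h {x ∷ xs} (px ∷ pxs) = begin
  g x + sum (map g xs)       ≡⟨ cong₂ _+_ (g≡c*h px) (sum-map-scale c g≡c*h pxs) ⟩
  c * h x + c * sum (map h xs) ≡⟨ sym (*-distribˡ-+ c (h x) _) ⟩
  c * (h x + sum (map h xs))   ∎

maybeToList-map : ∀ {A B : Set} (g : A → B) (m : Maybe A) →
  maybeToList (Maybe.map g m) ≡ map g (maybeToList m)
maybeToList-map g nothing  = refl
maybeToList-map g (just x) = refl

down-two : ∀ w → down (two ∷ w) ≡ (one ∷ w) ∷ map (two ∷_) (down w)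
down-two w = cong ((one ∷ w) ∷_) (begin
  map (two ∷_) (rule1 w) ++ maybeToList (Maybe.map (two ∷_) (rule2 w))
    ≡⟨ cong (map (two ∷_) (rule1 w) ++_) (maybeToList-map (two ∷_) (rule2 w)) ⟩
  map (two ∷_) (rule1 w) ++ map (two ∷_) (maybeToList (rule2 w))
    ≡⟨ sym (map-++ (two ∷_) (rule1 w) _) ⟩
  map (two ∷_) (down w) ∎)

down-rank : ∀ w → All (λ v → suc (rank v) ≡ rank w) (down w)
down-rank []        = []
down-rank (one ∷ w) = refl ∷ []
down-rank (two ∷ w) rewrite down-two w =
  refl ∷ map⁺ (All.map (cong (suc ∘ suc)) (down-rank w))

-- fAux agrees with f only when the fuel is exactly the rank, hence the hypothesis rank w ≡ m.
fAux-two : ∀ m w → rank w ≡ m → fAux (suc (suc m)) (two ∷ w) ≡ suc m * fAux m w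
fAux-two zero    []        refl = refl
fAux-two zero    (one ∷ w) ()
fAux-two zero    (two ∷ w) ()
fAux-two (suc m) w         r≡   = begin
  fAux (3 + m) (two ∷ w)
    ≡⟨ cong (sum ∘ map (fAux (2 + m))) (down-two w) ⟩
  (S + 0) + sum (map (fAux (2 + m)) (map (two ∷_) (down w)))
    ≡⟨ cong₂ _+_ (+-identityʳ S) (cong sum (sym (map-∘ (down w)))) ⟩
  S + sum (map (fAux (2 + m) ∘ (two ∷_)) (down w))
    ≡⟨ cong (S +_) (sum-map-scale (suc m) (λ {v} → fAux-two m v) down-rank-m) ⟩
  (2 + m) * S ∎
  where
  S : ℕ
  S = fAux (suc m) w
  down-rank-m : All (λ v → rank v ≡ m) (down w)
  down-rank-m = All.map (λ r → suc-injective (trans r r≡)) (down-rank w)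

suffixRankProduct : ℕ → Word → ℕ
suffixRankProduct c []        = 1
suffixRankProduct c (one ∷ w) = suffixRankProduct c w
suffixRankProduct c (two ∷ w) = suc (rank w + c) * suffixRankProduct c w

f≡suffixRankProduct : ∀ w → f w ≡ suffixRankProduct 0 w
f≡suffixRankProduct []        = refl
f≡suffixRankProduct (one ∷ w) = trans (+-identityʳ (f w)) (f≡suffixRankProduct w)
f≡suffixRankProduct (two ∷ w) = begin
  f (two ∷ w)                       ≡⟨ fAux-two (rank w) w refl ⟩
  suc (rank w) * f w                ≡⟨ cong₂ (λ r p → suc r * p) (sym (+-identityʳ (rank w))) (f≡suffixRankProduct w) ⟩
  suffixRankProduct 0 (two ∷ w)     ∎

rank-++ : ∀ u v → rank (u ++ v) ≡ rank u + rank v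
rank-++ []        v = refl
rank-++ (one ∷ u) v = cong suc (rank-++ u v)
rank-++ (two ∷ u) v = cong (suc ∘ suc) (rank-++ u v)

suffixRankProduct-++ : ∀ c u v →
  suffixRankProduct c (u ++ v) ≡ suffixRankProduct (rank v + c) u * suffixRankProduct c v
suffixRankProduct-++ c []        v = sym (+-identityʳ (suffixRankProduct c v))
suffixRankProduct-++ c (one ∷ u) v = suffixRankProduct-++ c u v
suffixRankProduct-++ c (two ∷ u) v = begin
  suc (rank (u ++ v) + c) * suffixRankProduct c (u ++ v)
    ≡⟨ cong₂ (λ r p → suc r * p) rank≡ (suffixRankProduct-++ c u v) ⟩
  suc (rank u + (rank v + c)) * (suffixRankProduct (rank v + c) u * suffixRankProduct c v)
    ≡⟨ sym (*-assoc (suc (rank u + (rank v + c))) (suffixRankProduct (rank v + c) u) (suffixRankProduct c v)) ⟩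
  suffixRankProduct (rank v + c) (two ∷ u) * suffixRankProduct c v ∎
  where
  rank≡ : rank (u ++ v) + c ≡ rank u + (rank v + c)
  rank≡ = trans (cong (_+ c) (rank-++ u v)) (+-assoc (rank u) (rank v) c)

rank-blockWord : ∀ b → rank (blockWord b) ≡ 2
rank-blockWord b11 = refl
rank-blockWord b2  = refl

suffixRankProduct-blockWord : ∀ c b → suffixRankProduct (2 * c) (blockWord b) ≡ factor c b
suffixRankProduct-blockWord c b11 = refl
suffixRankProduct-blockWord c b2  = trans (*-identityʳ _) (+-comm 1 (2 * c))

blocksWord-suc : ∀ k (a : Fin (suc k) → Block) →
  blocksWord (suc k) a ≡ blocksWord k (a ∘ Fin.suc) ++ blockWord (a Fin.zero)
blocksWord-suc k a = begin
  concatMap blockWord (reverse (a Fin.zero ∷ map a (tabulate Fin.suc)))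
    ≡⟨ cong (λ bs → concatMap blockWord (reverse (a Fin.zero ∷ bs))) shifted ⟩
  concatMap blockWord (reverse (a Fin.zero ∷ bs))
    ≡⟨ cong (concatMap blockWord) (unfold-reverse (a Fin.zero) bs) ⟩
  concatMap blockWord (reverse bs ++ a Fin.zero ∷ [])
    ≡⟨ concatMap-++ blockWord (reverse bs) _ ⟩
  blocksWord k (a ∘ Fin.suc) ++ blockWord (a Fin.zero) ++ []
    ≡⟨ cong (blocksWord k (a ∘ Fin.suc) ++_) (++-identityʳ _) ⟩
  blocksWord k (a ∘ Fin.suc) ++ blockWord (a Fin.zero) ∎
  where
  bs : List Block
  bs = map (a ∘ Fin.suc) (allFin k)
  shifted : map a (tabulate Fin.suc) ≡ bs
  shifted = trans (map-tabulate Fin.suc a) (sym (map-tabulate id (a ∘ Fin.suc)))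

suffixRankProduct-blocksWord : ∀ k (a : Fin k → Block) c →
  suffixRankProduct (2 * c) (blocksWord k a) ≡ product (tabulate (λ i → factor (c + toℕ i) (a i)))
suffixRankProduct-blocksWord zero    a c = refl
suffixRankProduct-blocksWord (suc k) a c = begin
  suffixRankProduct (2 * c) (blocksWord (suc k) a)
    ≡⟨ cong (suffixRankProduct (2 * c)) (blocksWord-suc k a) ⟩
  suffixRankProduct (2 * c) (blocksWord k (a ∘ Fin.suc) ++ blockWord (a Fin.zero))
    ≡⟨ suffixRankProduct-++ (2 * c) (blocksWord k (a ∘ Fin.suc)) (blockWord (a Fin.zero)) ⟩
  suffixRankProduct (rank (blockWord (a Fin.zero)) + 2 * c) (blocksWord k (a ∘ Fin.suc))
    * suffixRankProduct (2 * c) (blockWord (a Fin.zero))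
    ≡⟨ cong₂ _*_ (cong (λ d → suffixRankProduct d (blocksWord k (a ∘ Fin.suc))) offset≡) (suffixRankProduct-blockWord c (a Fin.zero)) ⟩
  suffixRankProduct (2 * suc c) (blocksWord k (a ∘ Fin.suc)) * factor c (a Fin.zero)
    ≡⟨ cong (_* factor c (a Fin.zero)) (suffixRankProduct-blocksWord k (a ∘ Fin.suc) (suc c)) ⟩
  product (tabulate (λ i → factor (suc c + toℕ i) (a (Fin.suc i)))) * factor c (a Fin.zero)
    ≡⟨ *-comm (product (tabulate (λ i → factor (suc c + toℕ i) (a (Fin.suc i))))) _ ⟩
  factor c (a Fin.zero) * product (tabulate (λ i → factor (suc c + toℕ i) (a (Fin.suc i))))
    ≡⟨ cong₂ (λ d p → factor d (a Fin.zero) * product p) (sym (+-identityʳ c))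
         (tabulate-cong (λ i → cong (λ d → factor d (a (Fin.suc i))) (sym (+-suc c (toℕ i))))) ⟩
  product (tabulate (λ i → factor (c + toℕ i) (a i))) ∎
  where
  offset≡ : rank (blockWord (a Fin.zero)) + 2 * c ≡ 2 * suc c
  offset≡ = trans (cong (_+ 2 * c) (rank-blockWord (a Fin.zero))) (sym (*-suc 2 c))

suffixRankProduct≡blockProduct : ∀ k (a : Fin k → Block) →
  suffixRankProduct 0 (blocksWord k a) ≡ blockProduct k a
suffixRankProduct≡blockProduct k a = begin
  suffixRankProduct 0 (blocksWord k a)
    ≡⟨ suffixRankProduct-blocksWord k a 0 ⟩
  product (tabulate (λ i → factor (toℕ i) (a i)))
    ≡⟨ cong product (sym (map-tabulate id (λ i → factor (toℕ i) (a i)))) ⟩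
  blockProduct k a ∎

mainTheorem2 : (k : ℕ) (a : Fin k → Block) →
    (f (blocksWord k a) ≡ blockProduct k a) × (f (one ∷ blocksWord k a) ≡ blockProduct k a)
mainTheorem2 k a =
  trans (f≡suffixRankProduct (blocksWord k a)) (suffixRankProduct≡blockProduct k a) ,
  trans (f≡suffixRankProduct (one ∷ blocksWord k a)) (suffixRankProduct≡blockProduct k a)
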